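{- Let $G$ be a directed graph, $T\subseteq V(G)$, $k$ a nonnegative integer, and $\mathcal{I}_k$ as defined below. If $W\in\mathcal{I}_k$ and $v$ is in the exact reverse shadow of $W$, then $W$ is an important $v-T$ separator.
   Context: $G$ has a (possibly empty) set $V^\infty(G)$ of undeletable vertices. For disjoint nonempty $A,B\subseteq V(G)$, a set $W\subseteq V(G)\setminus(A\cup B\cup V^\infty(G))$ is an $A-B$ separator if $G\setminus W$ has no path from $A$ to $B$; it is minimal if no proper subset is an $A-B$ separator. We write $v-T$ for $\{v\}-T$. $R^+_H(A)$ is the set of vertices reachable from $A$ in $H$. A minimal $A-B$ separator $W$ is important if there is no $A-B$ separator $W'$ with $|W'|\le|W|$ and $R^+_{G\setminus W}(A)\subsetneq R^+_{G\setminus W'}(A)$. $\mathcal{I}_k$ is the collection of sets $W\subseteq V(G)$ such that $W$ is an important $w-T$ separator of size at most $k$ for some vertex $w\in V(G)\setminus T$. A vertex $v$ is in the exact reverse shadow of $W$ (with respect to $T$) if $W$ is a minimal $v-T$ separator. -}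

module Defs where

open import Data.Nat using (ℕ; _≤_)
open import Data.Fin using (Fin)
open import Data.Fin.Subset using (Subset; _∈_; _∉_; _⊂_; ∣_∣; ⁅_⁆)
open import Data.Product using (Σ; ∃; _×_)
open import Relation.Nullary using (¬_)

-- A directed graph on vertex set Fin n: an arbitrary edge relation E,
-- together with a set U = V^∞(G) of undeletable vertices.
record Digraph : Set₁ where
  field
    n    : ℕ
    E    : Fin n → Fin n → Set
    Vinf : Subset n

open Digraph public

module _ (G : Digraph) where
  private
    V = Fin (n G)

  data Reach (W A : Subset (n G)) : V → Set where
    start : ∀ {a} → a ∈ A → a ∉ W → Reach W A a
    step  : ∀ {u v} → Reach W A u → E G u v → v ∉ W → Reach W A v

  Separator : Subset (n G) → Subset (n G) → Subset (n G) → Set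
  Separator A B W =
    (∀ x → x ∈ W → x ∉ A × x ∉ B × x ∉ Vinf G)
    × ¬ (∃ λ b → b ∈ B × Reach W A b)

  MinimalSeparator : Subset (n G) → Subset (n G) → Subset (n G) → Set
  MinimalSeparator A B W =
    Separator A B W × (∀ W′ → W′ ⊂ W → ¬ Separator A B W′)

  ReachStrictSub : Subset (n G) → Subset (n G) → Subset (n G) → Set
  ReachStrictSub A W W′ =
    (∀ v → Reach W A v → Reach W′ A v) × (∃ λ v → Reach W′ A v × ¬ Reach W A v)

  ImportantSeparator : Subset (n G) → Subset (n G) → Subset (n G) → Set
  ImportantSeparator A B W =
    MinimalSeparator A B W
    × ¬ (∃ λ W′ → Separator A B W′ × ∣ W′ ∣ ≤ ∣ W ∣ × ReachStrictSub A W W′)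

  InI : Subset (n G) → ℕ → Subset (n G) → Set
  InI T k W = ∃ λ w → w ∉ T × ImportantSeparator ⁅ w ⁆ T W × ∣ W ∣ ≤ k

  ExactReverseShadow : Subset (n G) → Subset (n G) → Fin (n G) → Set
  ExactReverseShadow T W v = MinimalSeparator ⁅ v ⁆ T W

module Submission where

-- Let W be an important w-T separator which is also a minimal v-T
-- separator, and suppose some v-T separator W′ with |W′| ≤ |W| reaches
-- strictly more from v than W does.  Then some x ∈ W is reachable from v
-- in G ∖ W′, and, by minimality of W as a w-T separator, x has an
-- in-neighbour u reachable from w in G ∖ W.  The set
--     W* = W′ ∖ R⁺_{G∖W}(w)
-- is a w-T separator: every vertex reachable from w in G ∖ W* is reachable
-- from w in G ∖ W or from v in G ∖ W′ (here minimality of W as a v-T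
-- separator is used).  Moreover |W*| ≤ |W′| ≤ |W|, and G ∖ W* reaches
-- everything G ∖ W reaches plus x, contradicting importance of W.
--
-- Reachability along an arbitrary edge relation is undecidable, so the
-- argument runs in the double-negation monad (the goal is ⊥), where
-- reachability over the finite vertex set may be assumed decidable and W*
-- formed by comprehension.

open import Defs
open import Data.Nat using (ℕ; _≤_)
open import Data.Nat.Properties using (≤-trans)
open import Data.Fin using (Fin; zero; suc)
open import Data.Fin.Properties using (_≟_)
open import Data.Fin.Subset using (Subset; ⁅_⁆; _∈_; _∉_; _⊆_; _-_; ∣_∣)
open import Data.Fin.Subset.Properties
  using (_∈?_; p⊆q⇒∣p∣≤∣q∣; p─q⊆p; x∈p⇒p-x⊂p; x∈p∧x≢y⇒x∈p-y)
open import Data.Vec using (tabulate)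
open import Data.Vec.Properties using ([]=⇒lookup; lookup⇒[]=; lookup∘tabulate)
open import Data.Bool using (true)
open import Data.Product using (∃; _×_; _,_; proj₁; proj₂)
open import Data.Empty using (⊥)
open import Function using (_∘_)
open import Relation.Nullary using (¬_; Dec; yes; no; does; ¬?; _×-dec_)
open import Relation.Nullary.Decidable using (¬¬-excluded-middle; dec-true)
open import Relation.Binary.PropositionalEquality using (_≡_; refl; trans; sym)

¬¬-decidable : ∀ {m} (P : Fin m → Set) → ¬ ¬ (∀ z → Dec (P z))
¬¬-decidable {ℕ.zero}  P k = k λ ()
¬¬-decidable {ℕ.suc m} P k =
  ¬¬-excluded-middle λ P₀? →
  ¬¬-decidable (P ∘ suc) λ Pₛ? →
  k λ { zero → P₀? ; (suc z) → Pₛ? z }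

module _ {m : ℕ} {P : Fin m → Set} (P? : ∀ z → Dec (P z)) where

  comprehension : Subset m
  comprehension = tabulate (does ∘ P?)

  ∈-comprehension⁺ : ∀ z → P z → z ∈ comprehension
  ∈-comprehension⁺ z p =
    lookup⇒[]= z comprehension (trans (lookup∘tabulate (does ∘ P?) z) (dec-true (P? z) p))

  ∈-comprehension⁻ : ∀ z → z ∈ comprehension → P z
  ∈-comprehension⁻ z z∈ = witness (P? z) (trans (sym (lookup∘tabulate (does ∘ P?) z)) ([]=⇒lookup z∈))
    where
    witness : ∀ {A : Set} (a? : Dec A) → does a? ≡ true → A
    witness (yes a) _ = a

module _ (G : Digraph) where

  reach⇒∉ : ∀ {W A x} → Reach G W A x → x ∉ W
  reach⇒∉ (start _ x∉W)  = x∉W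
  reach⇒∉ (step _ _ x∉W) = x∉W

  reach-mono : ∀ {W W′ A} → (∀ {z} → Reach G W A z → z ∉ W′)
    → ∀ z → Reach G W A z → Reach G W′ A z
  reach-mono avoids z r@(start a∈A _)   = start a∈A (avoids r)
  reach-mono avoids z r@(step {u} ru e _) = step (reach-mono avoids u ru) e (avoids r)

  source-reach : ∀ {A B W a} → Separator G A B W → a ∈ A → Reach G W A a
  source-reach {a = a} (avoid , _) a∈A = start a∈A (λ a∈W → proj₁ (avoid a a∈W) a∈A)

  escape : ∀ {A W W′} → ReachStrictSub G A W W′ → ¬ ¬ (∃ λ x → x ∈ W × Reach G W′ A x)
  escape (_ , y , r′y , ¬ry) k = ¬ry (reach-mono (λ {z} r z∈W → k (z , z∈W , r)) y r′y)

  -- Every vertex x of a minimal A-B separator W has an in-neighbour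
  -- reachable from A in G ∖ W; otherwise W - x would still separate.
  minimal⇒in-neighbour : ∀ {A B W x} → MinimalSeparator G A B W → x ∈ W
    → ¬ ¬ (∃ λ u → Reach G W A u × E G u x)
  minimal⇒in-neighbour {A} {B} {W} {x} ((avoid , no-path) , minimal) x∈W no-in-neighbour =
    minimal (W - x) (x∈p⇒p-x⊂p x∈W) (avoid⁻ , no-path⁻)
    where
    avoid⁻ : ∀ z → z ∈ W - x → z ∉ A × z ∉ B × z ∉ Vinf G
    avoid⁻ z z∈ = avoid z (p─q⊆p W ⁅ x ⁆ z∈)

    -- G ∖ (W - x) reaches only what G ∖ W reaches, as x is never entered.
    shrink : ∀ y → Reach G (W - x) A y → Reach G W A y
    shrink y (start a∈A _) = start a∈A (λ y∈W → proj₁ (avoid y y∈W) a∈A)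
    shrink y (step {u} ru e y∉W-x) = step (shrink u ru) e y∉W
      where
      y∉W : y ∉ W
      y∉W y∈W with y ≟ x
      ... | yes refl = no-in-neighbour (u , shrink u ru , e)
      ... | no y≢x   = y∉W-x (x∈p∧x≢y⇒x∈p-y y∈W y≢x)

    no-path⁻ : ¬ (∃ λ b → b ∈ B × Reach G (W - x) A b)
    no-path⁻ (b , b∈B , r) = no-path (b , b∈B , shrink b r)

  module Pushed {A W W′ : Subset (n G)} (reach? : ∀ z → Dec (Reach G W A z)) where

    InW* : Fin (n G) → Set
    InW* z = z ∈ W′ × ¬ Reach G W A z

    InW*? : ∀ z → Dec (InW* z)
    InW*? z = z ∈? W′ ×-dec ¬? (reach? z)

    W* : Subset (n G)
    W* = comprehension InW*?

    W*⊆W′ : W* ⊆ W′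
    W*⊆W′ {z} z∈ = proj₁ (∈-comprehension⁻ InW*? z z∈)

    W′∖W*-reached : ∀ {z} → z ∈ W′ → z ∉ W* → ¬ ¬ Reach G W A z
    W′∖W*-reached {z} z∈W′ z∉W* ¬r = z∉W* (∈-comprehension⁺ InW*? z (z∈W′ , ¬r))

    reach-kept : ∀ z → Reach G W A z → Reach G W* A z
    reach-kept = reach-mono (λ {z} r z∈W* → proj₂ (∈-comprehension⁻ InW*? z z∈W*) r)

    reach-covered : ∀ {B C} → (∀ z → z ∈ W → z ∉ A) → MinimalSeparator G C B W
      → (∀ z → Reach G W C z → Reach G W′ C z)
      → ∀ z → Reach G W* A z → ¬ Reach G W A z → ¬ Reach G W′ C z → ⊥
    reach-covered W∌A _ _ z (start a∈A _) ¬r _ = ¬r (start a∈A (λ z∈W → W∌A z z∈W a∈A))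
    reach-covered {B} {C} W∌A minW widen z (step {u} ru e z∉W*) ¬r ¬r′ =
      reach-covered W∌A minW widen u ru ¬ru (λ r′u → ¬enter r′u e)
      where
      ¬enter : ∀ {u′} → Reach G W′ C u′ → E G u′ z → ⊥
      ¬enter r′u′ e′ with z ∈? W′
      ... | yes z∈W′ = W′∖W*-reached z∈W′ z∉W* ¬r
      ... | no z∉W′  = ¬r′ (step r′u′ e′ z∉W′)

      -- If u were reachable in G ∖ W, then z ∈ W; but then z has an
      -- in-neighbour reachable from C in G ∖ W, hence in G ∖ W′.
      ¬ru : ¬ Reach G W A u
      ¬ru rwu with z ∈? W
      ... | no z∉W  = ¬r (step rwu e z∉W)
      ... | yes z∈W = minimal⇒in-neighbour minW z∈W λ (u′ , rcu′ , e′) → ¬enter (widen u′ rcu′) e′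

    W*-separator : ∀ {B C} → Separator G A B W → MinimalSeparator G C B W
      → Separator G C B W′ → (∀ z → Reach G W C z → Reach G W′ C z)
      → Separator G A B W*
    W*-separator {B} sepW@(avoid , no-path) minW (avoid′ , no-path′) widen = avoid* , no-path*
      where
      avoid* : ∀ z → z ∈ W* → z ∉ A × z ∉ B × z ∉ Vinf G
      avoid* z z∈W* =
        (λ z∈A → proj₂ (∈-comprehension⁻ InW*? z z∈W*) (source-reach sepW z∈A))
        , proj₂ (avoid′ z (W*⊆W′ z∈W*))

      no-path* : ¬ (∃ λ b → b ∈ B × Reach G W* A b)
      no-path* (b , b∈B , r) =
        reach-covered (λ z z∈W → proj₁ (avoid z z∈W)) minW widen b r
          (λ rw → no-path (b , b∈B , rw)) (λ r′ → no-path′ (b , b∈B , r′))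

    reach-grows : ∀ {C x u} → x ∈ W → Reach G W′ C x → Reach G W A u → E G u x
      → ReachStrictSub G A W W*
    reach-grows x∈W r′x rwu e =
      reach-kept , _ , step (reach-kept _ rwu) e (reach⇒∉ r′x ∘ W*⊆W′) , λ rwx → reach⇒∉ rwx x∈W

lemma5 : (G : Digraph) (T : Subset (n G)) (k : ℕ) (W : Subset (n G)) (v : Fin (n G))
    → InI G T k W → ExactReverseShadow G T W v
    → ImportantSeparator G ⁅ v ⁆ T W
lemma5 G T k W v (w , _ , (minW , important) , _) shadow = shadow , ¬improvable
  where
  ¬improvable : ¬ (∃ λ W′ → Separator G ⁅ v ⁆ T W′ × ∣ W′ ∣ ≤ ∣ W ∣ × ReachStrictSub G ⁅ v ⁆ W W′)
  ¬improvable (W′ , sepW′ , |W′|≤|W| , strict@(widen , _)) =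
    ¬¬-decidable (Reach G W ⁅ w ⁆) λ reach? →
    escape G strict λ (x , x∈W , r′x) →
    minimal⇒in-neighbour G minW x∈W λ (u , rwu , e) →
    let open Pushed G {W′ = W′} reach? in
    important ( W*
              , W*-separator (proj₁ minW) shadow sepW′ widen
              , ≤-trans (p⊆q⇒∣p∣≤∣q∣ W*⊆W′) |W′|≤|W|
              , reach-grows x∈W r′x rwu e )
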